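{- Let $C=\{(x,y,z):x,y,z\ge 0\}$ be the coordinate cone, let $T$ be the unit coordinate tetrahedron with vertices $(0,0,0),(1,0,0),(0,1,0),(0,0,1)$, let $d$ be a positive integer and $\varepsilon$ a positive real number. Then there are only finitely many integer planes at integer distance at most $d$ from the origin $O$ that divide $C$ into two nonempty parts such that one of these parts is bounded and contains the $\varepsilon$-dilate $\varepsilon T$ of $T$.
   Context: A plane is integer if its intersection with $\mathbb Z^3$ is a two-dimensional lattice. For an integer plane $\pi$ not through the integer point $A$, the integer distance $\mathrm{Id}(A,\pi)$ is the index of the sublattice generated by all integer vectors from $A$ to integer points of $\pi$ in the lattice of integer vectors of $\mathbb R^3$ (if $\pi=\{a\cdot u=b\}$ with $a$ a primitive integer vector, $\mathrm{Id}(O,\pi)=|b|$).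
   Formalization: The number ε is a positive rational rather than a positive real, and the cone C, the dilate εT and the two parts of C consist of points of ℚ³ instead of ℝ³. -}

module Defs where

open import Data.Nat as ℕ using (ℕ)
open import Data.Nat.GCD as ℕG using ()
open import Data.Integer as ℤ using (ℤ)
open import Data.Rational as ℚ using (ℚ; 0ℚ; _+_; _*_; _≤_; _<_; ∣_∣)
open import Data.Product using (_×_; _,_; ∃-syntax; Σ-syntax)
open import Data.Sum using (_⊎_)
open import Data.List using (List)
open import Data.List.Membership.Propositional using (_∈_)
open import Relation.Binary.PropositionalEquality using (_≡_)
open import Relation.Nullary using (¬_)
open import Function.Bundles using (_⇔_)

-- Points of (the rational points of) R^3.
Point : Set
Point = ℚ × ℚ × ℚ

toℚ : ℤ → ℚ
toℚ n = n ℚ./ 1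

Primitive : ℤ × ℤ × ℤ → Set
Primitive (a₁ , a₂ , a₃) = ℕG.gcd ℤ.∣ a₁ ∣ (ℕG.gcd ℤ.∣ a₂ ∣ ℤ.∣ a₃ ∣) ≡ 1

-- An integer plane, presented as {u : a · u = b} with a primitive integer vector a
-- and b ∈ ℤ (every integer plane has such a presentation, unique up to sign).
record IntPlane : Set where
  constructor plane
  field
    normal    : ℤ × ℤ × ℤ
    isPrimitive : Primitive normal
    rhs       : ℤ
open IntPlane public

lin : ℤ × ℤ × ℤ → Point → ℚ
lin (a₁ , a₂ , a₃) (x , y , z) = toℚ a₁ * x + toℚ a₂ * y + toℚ a₃ * z

OnPlane : IntPlane → Point → Set
OnPlane π u = lin (normal π) u ≡ toℚ (rhs π)

SamePlane : IntPlane → IntPlane → Set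
SamePlane π π′ = ∀ u → OnPlane π u ⇔ OnPlane π′ u

NotThroughO : IntPlane → Set
NotThroughO π = ¬ (rhs π ≡ ℤ.0ℤ)

-- Integer distance Id(O, π) = |b| (for π not through O).
IdO : IntPlane → ℕ
IdO π = ℤ.∣ rhs π ∣

InC : Point → Set
InC (x , y , z) = (0ℚ ≤ x) × (0ℚ ≤ y) × (0ℚ ≤ z)

Part₁ Part₂ : IntPlane → Point → Set
Part₁ π u = InC u × (lin (normal π) u < toℚ (rhs π))
Part₂ π u = InC u × (toℚ (rhs π) < lin (normal π) u)

NonEmpty : (Point → Set) → Set
NonEmpty S = ∃[ u ] S u

Bounded : (Point → Set) → Set
Bounded S = ∃[ M ] ∀ {x y z} → S (x , y , z) → (∣ x ∣ ≤ M) × (∣ y ∣ ≤ M) × (∣ z ∣ ≤ M)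

InεT : ℚ → Point → Set
InεT ε (x , y , z) = InC (x , y , z) × (x + y + z ≤ ε)

_⊆_ : (Point → Set) → (Point → Set) → Set
S ⊆ S′ = ∀ u → S u → S′ u

GoodPart : ℚ → (Point → Set) → Set
GoodPart ε P = Bounded P × (InεT ε ⊆ P)

Qualifies : ℕ → ℚ → IntPlane → Set
Qualifies d ε π =
  NotThroughO π × (IdO π ℕ.≤ d)
  × NonEmpty (Part₁ π) × NonEmpty (Part₂ π)
  × (GoodPart ε (Part₁ π) ⊎ GoodPart ε (Part₂ π))

FinitelyManyPlanes : (IntPlane → Set) → Set
FinitelyManyPlanes P = ∃[ L ] ∀ π → P π → ∃[ π′ ] (π′ ∈ L) × SamePlane π π′

{-# OPTIONS --safe #-}
-- On the i-th coordinate axis the part of C cut off by a·u = b is {t ≥ 0 : aᵢ t < b} (or > b).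
-- If this part is bounded and contains εT, that set is a bounded interval containing [0, ε],
-- so aᵢ has the sign of b, and |aᵢ| ε < |b| with ε ≥ 1/den ε gives |aᵢ| < |b| den ε ≤ d den ε.
-- Hence both the primitive normal a and the right-hand side b range over finite boxes.
-- The side a·u > b reduces to the side a·u < b by negating a and b.
module Submission where

open import Data.Nat as ℕ using (ℕ; suc; s≤s; _≤_)
open import Data.Rational as ℚ using (ℚ; 0ℚ; 1ℚ; _<_; _+_; _*_; -_; ∣_∣; ↥_; ↧ₙ_; toℚᵘ)
open import Defs

open import Algebra.Properties.Group using (⁻¹-involutive)
open import Data.Empty using (⊥-elim)
open import Data.Fin using (Fin)
open import Data.Fin.Patterns using (0F; 1F; 2F)
open import Data.Integer as ℤ using (ℤ; +_; +[1+_]; -[1+_])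
import Data.Integer.Properties as ℤP
open import Data.List using (List; []; [_]; _++_; map; concatMap; upTo; cartesianProduct)
open import Data.List.Membership.Propositional using (_∈_; lose)
open import Data.List.Membership.Propositional.Properties
  using (∈-concatMap⁺; ∈-cartesianProduct⁺; ∈-++⁺ˡ; ∈-++⁺ʳ; ∈-map⁺; ∈-upTo⁺)
open import Data.List.Relation.Unary.Any using (here)
import Data.Nat.GCD as ℕG
import Data.Nat.Properties as ℕP
open import Data.Product using (_×_; _,_; proj₁; proj₂; ∃-syntax; uncurry)
import Data.Rational.Properties as ℚP
open import Data.Rational.Unnormalised as ℚᵘ using (mkℚᵘ; *<*)
import Data.Rational.Unnormalised.Properties as ℚᵘP
open import Data.Sum using (_⊎_; inj₁; inj₂)
import Function.Properties.Equivalence as ⇔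
open import Relation.Binary.PropositionalEquality
  using (_≡_; refl; sym; trans; cong; subst; subst₂)
open import Relation.Nullary using (¬_; Dec; yes; no)

toℚᵘ-toℚ : ∀ i → toℚᵘ (toℚ i) ℚᵘ.≃ mkℚᵘ i 0
toℚᵘ-toℚ i = ℚP.toℚᵘ-fromℚᵘ (mkℚᵘ i 0)

toℚ-cancel-< : ∀ {i j} → toℚ i < toℚ j → i ℤ.< j
toℚ-cancel-< {i} {j} i<j
  with ℚᵘP.<-respʳ-≃ (toℚᵘ-toℚ j) (ℚᵘP.<-respˡ-≃ (toℚᵘ-toℚ i) (ℚP.toℚᵘ-mono-< i<j))
... | *<* i*1<j*1 = subst₂ ℤ._<_ (ℤP.*-identityʳ i) (ℤP.*-identityʳ j) i*1<j*1

cross-multiply-< : ∀ i p j → toℚ i * p < toℚ j → i ℤ.* ↥ p ℤ.< j ℤ.* + ↧ₙ p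
cross-multiply-< i p@record{} j ip<j
  with ℚᵘP.<-respʳ-≃ (toℚᵘ-toℚ j) (ℚᵘP.<-respˡ-≃ toℚᵘ-ip (ℚP.toℚᵘ-mono-< ip<j))
  where
  toℚᵘ-ip : toℚᵘ (toℚ i * p) ℚᵘ.≃ mkℚᵘ i 0 ℚᵘ.* toℚᵘ p
  toℚᵘ-ip = ℚᵘP.≃-trans (ℚP.toℚᵘ-homo-* (toℚ i) p) (ℚᵘP.*-congʳ (toℚᵘ-toℚ i))
... | *<* k = subst₂ ℤ._<_ (ℤP.*-identityʳ _) (cong (λ n → j ℤ.* + n) (ℕP.*-identityˡ (↧ₙ p))) k

ℚ-neg-involutive : ∀ p → - - p ≡ p
ℚ-neg-involutive = ⁻¹-involutive ℚP.+-0-group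

toℚ-neg : ∀ i → toℚ (ℤ.- i) ≡ - toℚ i
toℚ-neg (+ 0)    = refl
toℚ-neg +[1+ n ] = refl
toℚ-neg -[1+ n ] = sym (ℚ-neg-involutive (toℚ +[1+ n ]))

neg-cancel-< : ∀ {p q} → - p < - q → q < p
neg-cancel-< {p} {q} -p<-q =
  subst₂ _<_ (ℚ-neg-involutive q) (ℚ-neg-involutive p) (ℚP.neg-antimono-< -p<-q)

toℚ-neg-* : ∀ i t → toℚ (ℤ.- i) * t ≡ - (toℚ i * t)
toℚ-neg-* i t = trans (cong (_* t) (toℚ-neg i)) (sym (ℚP.neg-distribˡ-* (toℚ i) t))

cleared-denominator-bound : ∀ {i j k : ℤ} {d : ℕ} → + 0 ℤ.< i → + 0 ℤ.< k →
  i ℤ.* k ℤ.< j ℤ.* + suc d → ℤ.∣ i ∣ ≤ ℤ.∣ j ∣ ℕ.* suc d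
cleared-denominator-bound {+[1+ m ]} {+[1+ n ]} {+[1+ l ]} _ _ (ℤ.+<+ mk<nd) =
  ℕP.<⇒≤ (ℕP.≤-<-trans (ℕP.m≤m*n (suc m) (suc l)) mk<nd)
cleared-denominator-bound {+[1+ m ]} {+ 0}      {+[1+ l ]} _ _ (ℤ.+<+ ())
cleared-denominator-bound {+[1+ m ]} { -[1+ n ]} {+[1+ l ]} _ _ ()
cleared-denominator-bound {+ 0}      (ℤ.+<+ ()) _ _
cleared-denominator-bound { -[1+ m ]} () _ _
cleared-denominator-bound {+[1+ m ]} {k = + 0} _ (ℤ.+<+ ()) _
cleared-denominator-bound {+[1+ m ]} {k = -[1+ l ]} _ () _

positive-slope-bound : ∀ (i j : ℤ) {ε : ℚ} → 0ℚ < ε → 0ℚ < toℚ i → toℚ i * ε < toℚ j →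
  ℤ.∣ i ∣ ≤ ℤ.∣ j ∣ ℕ.* ↧ₙ ε
positive-slope-bound i j {ε@record{}} 0<ε 0<i iε<j = cleared-denominator-bound {i} {j}
  (toℚ-cancel-< 0<i) (ℤP.positive⁻¹ (↥ ε) {{ℚ.positive 0<ε}}) (cross-multiply-< i ε j iε<j)

ray-unbounded : ∀ M → ¬ (∀ t → 0ℚ ℚ.≤ t → ∣ t ∣ ℚ.≤ M)
ray-unbounded M bounded = ℚP.<-irrefl refl (ℚP.<-≤-trans M<M+1 M+1≤M)
  where
  M<M+1 : M < M + 1ℚ
  M<M+1 = subst (_< M + 1ℚ) (ℚP.+-identityʳ M) (ℚP.+-monoʳ-< M (ℚP.positive⁻¹ 1ℚ))
  0≤M+1 : 0ℚ ℚ.≤ M + 1ℚ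
  0≤M+1 = ℚP.≤-trans (bounded 0ℚ ℚP.≤-refl) (ℚP.<⇒≤ M<M+1)
  M+1≤M : M + 1ℚ ℚ.≤ M
  M+1≤M = subst (ℚ._≤ M) (ℚP.0≤p⇒∣p∣≡p 0≤M+1) (bounded (M + 1ℚ) 0≤M+1)

nonPos*nonNeg<pos : ∀ {α β t} → α ℚ.≤ 0ℚ → 0ℚ < β → 0ℚ ℚ.≤ t → α * t < β
nonPos*nonNeg<pos {α} {β} {t} α≤0 0<β 0≤t = ℚP.≤-<-trans αt≤0 0<β
  where
  αt≤0 : α * t ℚ.≤ 0ℚ
  αt≤0 = subst (α * t ℚ.≤_) (ℚP.*-zeroˡ t) (ℚP.*-monoʳ-≤-nonNeg t {{ℚ.nonNegative 0≤t}} α≤0)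

bounded-ray⇒0<slope : ∀ {α β M} → 0ℚ < β → (∀ t → 0ℚ ℚ.≤ t → α * t < β → ∣ t ∣ ℚ.≤ M) → 0ℚ < α
bounded-ray⇒0<slope {α} {β} {M} 0<β bounded with 0ℚ ℚP.<? α
... | yes 0<α = 0<α
... | no 0≮α  = ⊥-elim (ray-unbounded M λ t 0≤t →
  bounded t 0≤t (nonPos*nonNeg<pos (ℚP.≮⇒≥ 0≮α) 0<β 0≤t))

bounded-ray-slope-bound : ∀ (i j : ℤ) {ε M : ℚ} → 0ℚ < ε → 0ℚ < toℚ j → toℚ i * ε < toℚ j →
  (∀ t → 0ℚ ℚ.≤ t → toℚ i * t < toℚ j → ∣ t ∣ ℚ.≤ M) → ℤ.∣ i ∣ ≤ ℤ.∣ j ∣ ℕ.* ↧ₙ ε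
bounded-ray-slope-bound i j 0<ε 0<j iε<j bounded =
  positive-slope-bound i j 0<ε (bounded-ray⇒0<slope 0<j bounded) iε<j

neg-slope-< : ∀ i j t → toℚ j < toℚ i * t → toℚ (ℤ.- i) * t < toℚ (ℤ.- j)
neg-slope-< i j t j<it =
  subst₂ _<_ (sym (toℚ-neg-* i t)) (sym (toℚ-neg j)) (ℚP.neg-antimono-< j<it)

neg-slope-<⁻ : ∀ i j t → toℚ (ℤ.- i) * t < toℚ (ℤ.- j) → toℚ j < toℚ i * t
neg-slope-<⁻ i j t it<j = neg-cancel-< (subst₂ _<_ (toℚ-neg-* i t) (toℚ-neg j) it<j)

bounded-ray-slope-bound⁻ : ∀ (i j : ℤ) {ε M : ℚ} → 0ℚ < ε → toℚ j < 0ℚ → toℚ j < toℚ i * ε →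
  (∀ t → 0ℚ ℚ.≤ t → toℚ j < toℚ i * t → ∣ t ∣ ℚ.≤ M) → ℤ.∣ i ∣ ≤ ℤ.∣ j ∣ ℕ.* ↧ₙ ε
bounded-ray-slope-bound⁻ i j {ε} 0<ε j<0 j<iε bounded =
  subst₂ (λ m n → m ≤ n ℕ.* ↧ₙ ε) (ℤP.∣-i∣≡∣i∣ i) (ℤP.∣-i∣≡∣i∣ j)
    (bounded-ray-slope-bound (ℤ.- i) (ℤ.- j) 0<ε 0<-j (neg-slope-< i j ε j<iε)
      λ t 0≤t -it<-j → bounded t 0≤t (neg-slope-<⁻ i j t -it<-j))
  where
  0<-j : 0ℚ < toℚ (ℤ.- j)
  0<-j = subst (0ℚ <_) (sym (toℚ-neg j)) (ℚP.neg-antimono-< j<0)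

axis : Fin 3 → ℚ → Point
axis 0F t = t , 0ℚ , 0ℚ
axis 1F t = 0ℚ , t , 0ℚ
axis 2F t = 0ℚ , 0ℚ , t

coefficient : Fin 3 → ℤ × ℤ × ℤ → ℤ
coefficient 0F (a₁ , _ , _) = a₁
coefficient 1F (_ , a₂ , _) = a₂
coefficient 2F (_ , _ , a₃) = a₃

lin-axis : ∀ a i t → lin a (axis i t) ≡ toℚ (coefficient i a) * t
lin-axis (a₁ , a₂ , a₃) 0F t
  rewrite ℚP.*-zeroʳ (toℚ a₂) | ℚP.*-zeroʳ (toℚ a₃) | ℚP.+-identityʳ (toℚ a₁ * t) = ℚP.+-identityʳ _
lin-axis (a₁ , a₂ , a₃) 1F t
  rewrite ℚP.*-zeroʳ (toℚ a₁) | ℚP.*-zeroʳ (toℚ a₃) | ℚP.+-identityˡ (toℚ a₂ * t) = ℚP.+-identityʳ _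
lin-axis (a₁ , a₂ , a₃) 2F t
  rewrite ℚP.*-zeroʳ (toℚ a₁) | ℚP.*-zeroʳ (toℚ a₂) = ℚP.+-identityˡ _

axis-InC : ∀ i {t} → 0ℚ ℚ.≤ t → InC (axis i t)
axis-InC 0F 0≤t = 0≤t , ℚP.≤-refl , ℚP.≤-refl
axis-InC 1F 0≤t = ℚP.≤-refl , 0≤t , ℚP.≤-refl
axis-InC 2F 0≤t = ℚP.≤-refl , ℚP.≤-refl , 0≤t

axis-InεT : ∀ i {ε t} → 0ℚ ℚ.≤ t → t ℚ.≤ ε → InεT ε (axis i t)
axis-InεT i {ε} {t} 0≤t t≤ε = axis-InC i 0≤t , subst (ℚ._≤ ε) (sym (sum i)) t≤ε
  where
  sum : ∀ i → let (x , y , z) = axis i t in x + y + z ≡ t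
  sum 0F = trans (ℚP.+-identityʳ _) (ℚP.+-identityʳ t)
  sum 1F = trans (ℚP.+-identityʳ _) (ℚP.+-identityˡ t)
  sum 2F = ℚP.+-identityˡ t

axis-bounded : ∀ {S} (bounded : Bounded S) i {t} → S (axis i t) → ∣ t ∣ ℚ.≤ proj₁ bounded
axis-bounded (_ , bound) 0F s = proj₁ (bound s)
axis-bounded (_ , bound) 1F s = proj₁ (proj₂ (bound s))
axis-bounded (_ , bound) 2F s = proj₂ (proj₂ (bound s))

GoodPart-on-axis : ∀ {ε} (R : ℚ → Set) a → GoodPart ε (λ u → InC u × R (lin a u)) → ∀ i →
  let c = toℚ (coefficient i a) in
  ∃[ M ] (∀ t → 0ℚ ℚ.≤ t → R (c * t) → ∣ t ∣ ℚ.≤ M) × (∀ {t} → 0ℚ ℚ.≤ t → t ℚ.≤ ε → R (c * t))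
GoodPart-on-axis R a (bounded , εT⊆P) i =
  proj₁ bounded ,
  (λ t 0≤t Rct → axis-bounded bounded i (axis-InC i 0≤t , subst R (sym (lin-axis a i t)) Rct)) ,
  (λ 0≤t t≤ε → subst R (lin-axis a i _) (proj₂ (εT⊆P _ (axis-InεT i 0≤t t≤ε))))

CoefficientsBoundedBy : ℕ → ℤ × ℤ × ℤ → Set
CoefficientsBoundedBy N a = ∀ i → ℤ.∣ coefficient i a ∣ ≤ N

GoodPart₁⇒coefficient-bound : ∀ {ε} π → 0ℚ < ε → GoodPart ε (Part₁ π) →
  CoefficientsBoundedBy (ℤ.∣ rhs π ∣ ℕ.* ↧ₙ ε) (normal π)
GoodPart₁⇒coefficient-bound {ε} (plane a _ b) 0<ε good i
  with _ , bounded , below ← GoodPart-on-axis (_< toℚ b) a good i =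
  bounded-ray-slope-bound (coefficient i a) b 0<ε
    (subst (_< toℚ b) (ℚP.*-zeroʳ (toℚ (coefficient i a))) (below ℚP.≤-refl 0≤ε))
    (below 0≤ε ℚP.≤-refl) bounded
  where 0≤ε = ℚP.<⇒≤ 0<ε

GoodPart₂⇒coefficient-bound : ∀ {ε} π → 0ℚ < ε → GoodPart ε (Part₂ π) →
  CoefficientsBoundedBy (ℤ.∣ rhs π ∣ ℕ.* ↧ₙ ε) (normal π)
GoodPart₂⇒coefficient-bound {ε} (plane a _ b) 0<ε good i
  with _ , bounded , above ← GoodPart-on-axis (toℚ b <_) a good i =
  bounded-ray-slope-bound⁻ (coefficient i a) b 0<ε
    (subst (toℚ b <_) (ℚP.*-zeroʳ (toℚ (coefficient i a))) (above ℚP.≤-refl 0≤ε))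
    (above 0≤ε ℚP.≤-refl) bounded
  where 0≤ε = ℚP.<⇒≤ 0<ε

GoodPart⇒coefficient-bound : ∀ {ε} π → 0ℚ < ε →
  GoodPart ε (Part₁ π) ⊎ GoodPart ε (Part₂ π) →
  CoefficientsBoundedBy (ℤ.∣ rhs π ∣ ℕ.* ↧ₙ ε) (normal π)
GoodPart⇒coefficient-bound π 0<ε (inj₁ good) = GoodPart₁⇒coefficient-bound π 0<ε good
GoodPart⇒coefficient-bound π 0<ε (inj₂ good) = GoodPart₂⇒coefficient-bound π 0<ε good

qualifying-normal-bound : ∀ {d ε} π → 0ℚ < ε → Qualifies d ε π →
  CoefficientsBoundedBy (d ℕ.* ↧ₙ ε) (normal π)
qualifying-normal-bound {ε = ε} π 0<ε (_ , b≤d , _ , _ , good) i =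
  ℕP.≤-trans (GoodPart⇒coefficient-bound π 0<ε good i) (ℕP.*-monoˡ-≤ (↧ₙ ε) b≤d)

integersUpTo : ℕ → List ℤ
integersUpTo N = map +_ (upTo (suc N)) ++ map -[1+_] (upTo N)

∈-integersUpTo : ∀ {N} i → ℤ.∣ i ∣ ≤ N → i ∈ integersUpTo N
∈-integersUpTo (+ n)        n≤N = ∈-++⁺ˡ (∈-map⁺ +_ (∈-upTo⁺ (s≤s n≤N)))
∈-integersUpTo {N} -[1+ n ] n<N = ∈-++⁺ʳ (map +_ (upTo (suc N))) (∈-map⁺ -[1+_] (∈-upTo⁺ n<N))

boundedNormals : ℕ → List (ℤ × ℤ × ℤ)
boundedNormals N = cartesianProduct ℤs (cartesianProduct ℤs ℤs)
  where ℤs = integersUpTo N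

∈-boundedNormals : ∀ {N} a → CoefficientsBoundedBy N a → a ∈ boundedNormals N
∈-boundedNormals (a₁ , a₂ , a₃) bounded = ∈-cartesianProduct⁺ (∈-integersUpTo a₁ (bounded 0F))
  (∈-cartesianProduct⁺ (∈-integersUpTo a₂ (bounded 1F)) (∈-integersUpTo a₃ (bounded 2F)))

primitive? : ∀ a → Dec (Primitive a)
primitive? (a₁ , a₂ , a₃) = ℕG.gcd ℤ.∣ a₁ ∣ (ℕG.gcd ℤ.∣ a₂ ∣ ℤ.∣ a₃ ∣) ℕ.≟ 1

planesWith : ℤ × ℤ × ℤ → ℤ → List IntPlane
planesWith a b with primitive? a
... | yes p = [ plane a p b ]
... | no _  = []

∈-planesWith : ∀ a p b → plane a p b ∈ planesWith a b
∈-planesWith a p b with primitive? a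
... | yes p′ = here (cong (λ q → plane a q b) (ℕP.≡-irrelevant p p′))
... | no ¬p  = ⊥-elim (¬p p)

boundedPlanes : ℕ → ℕ → List IntPlane
boundedPlanes N d =
  concatMap (uncurry planesWith) (cartesianProduct (boundedNormals N) (integersUpTo d))

∈-boundedPlanes : ∀ {N d} a p b → CoefficientsBoundedBy N a → ℤ.∣ b ∣ ≤ d →
  plane a p b ∈ boundedPlanes N d
∈-boundedPlanes a p b a-bounded b≤d = ∈-concatMap⁺ (uncurry planesWith)
  (lose (∈-cartesianProduct⁺ (∈-boundedNormals a a-bounded) (∈-integersUpTo b b≤d))
        (∈-planesWith a p b))

lemma3p2 : (d : ℕ) → 1 ≤ d → (ε : ℚ) → 0ℚ < ε →
    FinitelyManyPlanes (Qualifies d ε)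
lemma3p2 d _ ε 0<ε = boundedPlanes (d ℕ.* ↧ₙ ε) d , listed
  where
  listed : ∀ π → Qualifies d ε π → ∃[ π′ ] (π′ ∈ boundedPlanes (d ℕ.* ↧ₙ ε) d) × SamePlane π π′
  listed π@(plane a p b) qualifies@(_ , b≤d , _) =
    π , ∈-boundedPlanes a p b (qualifying-normal-bound π 0<ε qualifies) b≤d , λ _ → ⇔.refl
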